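{- Let $n\ge2$, $m\ge1$ and let $v$ be a vertex of the dYoke graph $Z_{n,m}$ with $\operatorname{Piv}(v)=\{ -1,m+1\}$. Then $\operatorname{ps}_{m+1}(v)=\sum_{i=0}^{m+1} i\,v_i$, $\operatorname{ps}_{ -1}(v)=\sum_{i=0}^{m+1}(m+1-i)\,v_i$, and $d(v,0)\le\lfloor\frac{n(m+1)}{2}\rfloor$.
   Context: Elements of $\mathbb{Z}_n$ are identified with their smallest nonnegative representatives in $\{0,\dots,n-1\}$ (so $v_0,v_{m+1}$ are integers in $[0,n-1]$ in sums). The dYoke graph $Z_{n,m}$ has as vertices all tuples $u=(u_0,\dots,u_{m+1})$ with $u_0,u_{m+1}\in\mathbb{Z}_n$, $u_1,\dots,u_m\in\{ -1,0,1\}$ and $\sum_{i=0}^{m+1}u_i\equiv0\pmod n$; adjacency: there is $0\le i\le m$ with $u_j=v_j$ for $j\notin\{i,i+1\}$ and either ($u_i=v_i+1$, $u_{i+1}=v_{i+1}-1$) or ($u_i=v_i-1$, $u_{i+1}=v_{i+1}+1$), arithmetic in coordinates $0,m+1$ in $\mathbb{Z}_n$. $0$ is the all-zero vertex and $d$ is graph distance in $Z_{n,m}$. A pivot of $v$ is an integer $-1\le p\le m+1$ such that $n$ divides $\sum_{i=0}^{p}v_i$ (empty sum $=0$); $\operatorname{Piv}(v)$ is the set of pivots. For $0\le i\le m$, $\overleftarrow{s}_i(v)$ is obtained from $v$ by adding $1$ to entry $i$ and subtracting $1$ from entry $i+1$ if the result is a vertex (and is $v$ otherwise); $\overrightarrow{s}_i(v)$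 subtracts $1$ from entry $i$ and adds $1$ to entry $i+1$. The word of a path $v^0\sim\dots\sim v^d$ is $f_d\cdots f_1$ with $f_t(v^{t-1})=v^t$. For a path $P$ from $v$ to $0$ with word $w$: $0\le p\le m$ is a wall if neither $\overleftarrow{s}_p$ nor $\overrightarrow{s}_p$ occurs in $w$; $-1$ is a wall if $\overleftarrow{s}_0$ does not occur in $w$; $m+1$ is a wall if $\overrightarrow{s}_m$ does not occur in $w$. $\operatorname{ps}_p(v)$ denotes the minimum length of a path from $v$ to $0$ having $p$ as a wall. -}

module Defs where

open import Data.Nat as ℕ using (ℕ; zero; suc)
open import Data.Integer as ℤ using (ℤ; +_; -[1+_]; _+_; _-_; _*_; _≤_; _<_; ∣_∣)
open import Data.Integer.Divisibility using (_∣_)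
import Data.Fin
open import Data.Fin using (Fin; toℕ; inject₁; fromℕ)
open import Data.Vec using (Vec; lookup; toList; replicate; zipWith; tabulate)
open import Data.List as List using (List; []; _∷_; take)
open import Data.List.Membership.Propositional using (_∈_)
open import Data.Product using (Σ; _×_; _,_)
open import Data.Sum using (_⊎_)
open import Relation.Nullary using (¬_)
open import Relation.Binary.PropositionalEquality using (_≡_; _≢_)

zsumL : List ℤ → ℤ
zsumL = List.foldr _+_ (+ 0)

zsum : ∀ {k} → Vec ℤ k → ℤ
zsum v = zsumL (toList v)

weightedSum : ∀ {k} → (ℕ → ℤ) → Vec ℤ k → ℤ
weightedSum f v = zsum (zipWith _*_ (tabulate (λ i → f (toℕ i))) v)

-1ℤ : ℤ
-1ℤ = -[1+ 0 ]

-- A candidate vertex of Z_{n,m}: entries u_0, …, u_{m+1}, with u_0, u_{m+1}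
-- represented by their least nonnegative residues.
V : ℕ → Set
V m = Vec ℤ (suc (suc m))

module _ (n m : ℕ) where

  lastIx : Fin (suc (suc m))
  lastIx = fromℕ (suc m)

  IsVertex : V m → Set
  IsVertex u =
    (+ 0 ≤ lookup u Data.Fin.zero × lookup u Data.Fin.zero < + n) ×
    (+ 0 ≤ lookup u lastIx × lookup u lastIx < + n) ×
    (∀ (j : Fin m) → -1ℤ ≤ lookup u (Data.Fin.suc (inject₁ j)) × lookup u (Data.Fin.suc (inject₁ j)) ≤ + 1) ×
    (+ n ∣ zsum u)

  zeroV : V m
  zeroV = replicate _ (+ 0)

  -- coordinates 0 and m+1 live in ℤ_n
  IsEnd : Fin (suc (suc m)) → Set
  IsEnd j = toℕ j ≡ 0 ⊎ toℕ j ≡ suc m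

  CoordEq : Fin (suc (suc m)) → ℤ → ℤ → Set
  CoordEq j a b = (IsEnd j → + n ∣ (a - b)) × (¬ IsEnd j → a ≡ b)

  -- ←s_i is L (add 1 at i, subtract 1 at i+1), →s_i is R
  data Dir : Set where
    L R : Dir

  δ : Dir → ℤ
  δ L = + 1
  δ R = -1ℤ

  Move : Dir → Fin (suc m) → V m → V m → Set
  Move d i u v =
    IsVertex u × IsVertex v ×
    (∀ j → toℕ j ≢ toℕ i → toℕ j ≢ suc (toℕ i) → lookup v j ≡ lookup u j) ×
    CoordEq (inject₁ i) (lookup v (inject₁ i)) (lookup u (inject₁ i) + δ d) ×
    CoordEq (Data.Fin.suc i) (lookup v (Data.Fin.suc i)) (lookup u (Data.Fin.suc i) - δ d)

  Label : Set
  Label = Dir × Fin (suc m)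

  -- Path u w ws : a path from u to w whose sequence of operators is ws
  -- (ws lists f_1, …, f_d; the word f_d ⋯ f_1 has the same letters)
  data Path : V m → V m → List Label → Set where
    nil  : ∀ {u} → Path u u []
    cons : ∀ {u v w d i ws} → Move d i u v → Path v w ws → Path u w ((d , i) ∷ ws)

  Wall : ℤ → List Label → Set
  Wall p ws =
    (p ≡ -1ℤ → ¬ ((L , Data.Fin.zero) ∈ ws)) ×
    (p ≡ + suc m → ¬ ((R , fromℕ m) ∈ ws)) ×
    (∀ (i : Fin (suc m)) → p ≡ + toℕ i → ¬ ((L , i) ∈ ws) × ¬ ((R , i) ∈ ws))

  PsIs : ℤ → V m → ℕ → Set
  PsIs p v k =
    (Σ (List Label) λ ws → Path v zeroV ws × Wall p ws × List.length ws ≡ k) ×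
    (∀ ws → Path v zeroV ws → Wall p ws → k ℕ.≤ List.length ws)

  IsPivot : V m → ℤ → Set
  IsPivot v p = -1ℤ ≤ p × p ≤ + suc m × (+ n ∣ zsumL (take ∣ p + + 1 ∣ (toList v)))

module Submission where

-- Let Φ(u) = Σ i·u_i and Ψ(u) = Σ (m+1-i)·u_i. A move changes them only through
-- the two entries it touches, and every move other than →s_m lowers Φ by at most one (under
-- ←s_m the last entry can only wrap around upwards, from 0 to n-1). So a path from v to 0 with
-- wall m+1 has length at least Φ(v); dually a path with wall -1 has length at least Ψ(v).
--
-- As no p in [0, m] is a pivot, the prefix sums T_p = v_0 + … + v_p (p ≤ m) lie in
-- [1, n-1], move by at most one from p to p+1, and determine v. Raising a minimal T_p by one is the
-- move ←s_p, lowering a maximal T_p is the move →s_p; iterating reaches the constant profile n,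
-- resp. 0, which both encode the vertex 0, after μ↑ = Σ (n - T_p), resp. μ↓ = Σ T_p moves. These
-- paths have walls m+1, resp. -1, so Φ(v) ≤ μ↑ and Ψ(v) ≤ μ↓; since Φ(v) + Ψ(v) = (m+1)·n = μ↑ + μ↓
-- both are equalities. This gives both values of ps, and the shorter path has length ≤ ⌊n(m+1)/2⌋.

open import Defs
open import Data.Nat as ℕ using (ℕ; zero; suc; z≤n; s≤s)
import Data.Nat.Properties as ℕP
import Data.Nat.DivMod as ℕDivMod
import Data.Nat.Divisibility as ℕDiv
import Data.Nat.Tactic.RingSolver as ℕSolver
open import Data.Integer as ℤ using (ℤ; +_; -[1+_]; _+_; _-_; _*_; -_; _≤_; _<_; ∣_∣; +≤+; +<+; -≤+; -≤-)
import Data.Integer.Properties as ℤP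
import Data.Integer.DivMod as ℤDivMod
open import Data.Integer.Divisibility using (_∣_)
import Data.Integer.Divisibility.Signed as Signed
open import Data.Integer.Tactic.RingSolver using (solve-∀)
open import Data.Fin using (Fin; toℕ; inject₁; fromℕ; fromℕ<) renaming (zero to fz; suc to fs)
import Data.Fin.Properties as FinP
open import Data.Vec using (Vec; []; _∷_; lookup; replicate; tabulate; toList)
import Data.Vec.Properties as VecP
open import Data.List using (List; []; _∷_; length; take)
import Data.List.Properties as ListP
open import Data.List.Membership.Propositional using (_∈_)
open import Data.List.Relation.Unary.Any using (here; there)
open import Data.List.Relation.Unary.All as All using (All; []; _∷_)
open import Data.Product using (Σ; _×_; _,_; proj₁; proj₂)
open import Data.Sum using (_⊎_; inj₁; inj₂; [_,_]′; map₁)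
open import Data.Empty using (⊥-elim)
open import Relation.Nullary using (¬_; Dec; yes; no)
open import Relation.Nullary.Decidable using (_⊎-dec_)
open import Relation.Binary.PropositionalEquality
open import Function using (_∘_)
open import Function.Bundles using (_⇔_; Equivalence)

-- + (1 + t) in the form the ring solver produces.
+suc : ∀ t → + suc t ≡ + t + + 1
+suc t = trans (cong +_ (ℕP.+-comm 1 t)) (ℤP.pos-+ t 1)

-- i ≤ i + j for j ≥ 0 (the library states this with the sign of j as an instance).
≤-+-nonneg : ∀ i {j} → + 0 ≤ j → i ≤ i + j
≤-+-nonneg i {j} 0≤j = ℤP.i≤i+j i j {{ℤ.nonNegative 0≤j}}

*-nonneg : ∀ {i j} → + 0 ≤ i → + 0 ≤ j → + 0 ≤ i * j
*-nonneg {i} {j} 0≤i 0≤j =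
  subst (_≤ i * j) (ℤP.*-zeroʳ i) (ℤP.*-monoˡ-≤-nonNeg i {{ℤ.nonNegative 0≤i}} 0≤j)

squeeze : ∀ {a A b B : ℤ} → a ≤ A → b ≤ B → A + B ≡ a + b → a ≡ A
squeeze {a} {A} {b} {B} a≤A b≤B sums = ℤP.≤-antisym a≤A (begin
  A             ≡⟨ cancel A B ⟨
  A + B - B     ≡⟨ cong (_- B) sums ⟩
  a + b - B     ≤⟨ ℤP.+-monoʳ-≤ (a + b) (ℤP.neg-mono-≤ b≤B) ⟩
  a + b - b     ≡⟨ cancel a b ⟩
  a             ∎)
  where
  open ℤP.≤-Reasoning
  cancel : ∀ (x y : ℤ) → x + y - y ≡ x
  cancel = solve-∀

≤-suc-cases : ∀ {p k} → p ℕ.≤ suc k → p ℕ.≤ k ⊎ p ≡ suc k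
≤-suc-cases = map₁ ℕP.≤-pred ∘ ℕP.m≤n⇒m<n∨m≡n

≤-suc-pred : ∀ x → x ℕ.≤ suc (ℕ.pred x)
≤-suc-pred zero    = z≤n
≤-suc-pred (suc x) = ℕP.≤-refl

∸-step : ∀ {a b} → a ℕ.< b → b ℕ.∸ a ≡ suc (b ℕ.∸ suc a)
∸-step {zero}  {suc b} _         = refl
∸-step {suc a} {suc b} (s≤s a<b) = ∸-step a<b


at-most-half : ∀ x N → x ℕ.+ x ℕ.≤ N → x ℕ.≤ N ℕ./ 2
at-most-half x N 2x≤N =
  subst (ℕ._≤ N ℕ./ 2) (ℕDivMod.m*n/n≡m x 2) (ℕDivMod./-monoˡ-≤ 2 (subst (ℕ._≤ N) twice 2x≤N))
  where twice : x ℕ.+ x ≡ x ℕ.* 2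
        twice = trans (cong (x ℕ.+_) (sym (ℕP.+-identityʳ x))) (ℕP.*-comm 2 x)

half-of-sum : ∀ a b → a ℕ.≤ (a ℕ.+ b) ℕ./ 2 ⊎ b ℕ.≤ (a ℕ.+ b) ℕ./ 2
half-of-sum a b with ℕP.≤-total a b
... | inj₁ a≤b = inj₁ (at-most-half a (a ℕ.+ b) (ℕP.+-monoʳ-≤ a a≤b))
... | inj₂ b≤a = inj₂ (at-most-half b (a ℕ.+ b) (ℕP.+-monoˡ-≤ b b≤a))

multiple-between : ∀ n s → 1 ℕ.≤ s → s ℕ.< n ℕ.+ n → n ℕDiv.∣ s → s ≡ n
multiple-between n s 1≤s _ (ℕDiv.divides zero s≡0) = ⊥-elim (ℕP.<⇒≢ 1≤s (sym s≡0))
multiple-between n s _ _ (ℕDiv.divides 1 s≡n) = trans s≡n (ℕP.+-identityʳ n)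
multiple-between n s _ s<2n (ℕDiv.divides (suc (suc q)) s≡) =
  ⊥-elim (ℕP.<⇒≱ s<2n (subst (n ℕ.+ n ℕ.≤_) (sym s≡) (ℕP.+-monoʳ-≤ n (ℕP.m≤m+n n _))))


_≈₁_ : ℕ → ℕ → Set
a ≈₁ b = a ℕ.≤ suc b × b ℕ.≤ suc a

increment-bounds : ∀ {a b} → a ≈₁ b → -1ℤ ≤ + b - + a × + b - + a ≤ + 1
increment-bounds {a} {b} (a≤1+b , b≤1+a) = lower , upper
  where
  open ℤP.≤-Reasoning
  lower : -1ℤ ≤ + b - + a
  lower = begin
    -1ℤ           ≡⟨ drop-one (+ b) ⟨
    + b - + suc b ≤⟨ ℤP.+-monoʳ-≤ (+ b) (ℤP.neg-mono-≤ (+≤+ a≤1+b)) ⟩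
    + b - + a     ∎
    where drop-one : ∀ (B : ℤ) → B - (+ 1 + B) ≡ - + 1
          drop-one = solve-∀
  upper : + b - + a ≤ + 1
  upper = begin
    + b - + a     ≤⟨ ℤP.+-monoˡ-≤ (- + a) (+≤+ b≤1+a) ⟩
    + suc a - + a ≡⟨ add-one (+ a) ⟩
    + 1           ∎
    where add-one : ∀ (A : ℤ) → + 1 + A - A ≡ + 1
          add-one = solve-∀

add-increment : ∀ t x → 1 ℕ.≤ t → -1ℤ ≤ x → x ≤ + 1 → Σ ℕ λ t′ → + t + x ≡ + t′ × t ≈₁ t′
add-increment t       (+ zero)          _ _ _ = t , ℤP.+-identityʳ (+ t) , ℕP.n≤1+n t , ℕP.n≤1+n t
add-increment t       (+ suc zero)      _ _ _ = suc t , sym (+suc t) , ℕP.m≤n⇒m≤1+n (ℕP.n≤1+n t) , ℕP.≤-refl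
add-increment t       (+ suc (suc _))   _ _ (+≤+ (s≤s ()))
add-increment (suc t) -[1+ zero ]       _ _ _ = t , minus-one (+ t) , ℕP.≤-refl , ℕP.m≤n⇒m≤1+n (ℕP.n≤1+n t)
  where minus-one : ∀ (T : ℤ) → + 1 + T + -[1+ 0 ] ≡ T
        minus-one = solve-∀
add-increment t       -[1+ suc _ ]      _ (-≤- ()) _

-- Divisibility of integers (in the unsigned form used by the definitions) is closed under
-- sums and differences; we borrow these facts from signed divisibility.
-- (The unsigned relation only sees absolute values, so the terms are passed explicitly.)
∣-+ : ∀ {k} x y → k ∣ x → k ∣ y → k ∣ x + y
∣-+ {k} x y p q = Signed.∣⇒∣ᵤ {k} {x + y} (Signed.∣m∣n⇒∣m+n (Signed.∣ᵤ⇒∣ {k} {x} p) (Signed.∣ᵤ⇒∣ {k} {y} q))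

∣-- : ∀ {k} x y → k ∣ x → k ∣ y → k ∣ x - y
∣-- {k} x y p q = Signed.∣⇒∣ᵤ {k} {x - y} (Signed.∣m∣n⇒∣m-n (Signed.∣ᵤ⇒∣ {k} {x} p) (Signed.∣ᵤ⇒∣ {k} {y} q))

∣-0 : ∀ {k} → k ∣ + 0
∣-0 {k} = ∣ k ∣ ℕDiv.∣0


-- An end coordinate lowered by one modulo n stays in [0, n), so it cannot drop by more
-- than one: if 0 ≤ y, x < n and y ≡ x - 1 (mod n) then y ≥ x - 1.
wrap-down : ∀ {n x y} → + 0 ≤ y → x < + n → + n ∣ (y - (x - + 1)) → + 0 ≤ y - (x - + 1)
wrap-down {n} {x} {y} 0≤y x<n n∣z with y - (x - + 1) in eq
... | + _      = +≤+ z≤n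
... | -[1+ k ] = ⊥-elim (ℕP.<⇒≱ k+1<n (ℕDiv.∣⇒≤ n∣z))
  where
  open ℤP.≤-Reasoning
  x≡ : x ≡ y + + suc (suc k)
  x≡ = trans (recover x y) (cong (λ z → y + (+ 1 - z)) eq)
    where recover : ∀ (x y : ℤ) → x ≡ y + (+ 1 - (y - (x - + 1)))
          recover = solve-∀
  k+1<n : suc k ℕ.< n
  k+1<n = ℤP.drop‿+<+ (begin-strict
    + suc k                   <⟨ +<+ ℕP.≤-refl ⟩
    + suc (suc k)             ≤⟨ ℤP.i≤j+i _ y {{ℤ.nonNegative 0≤y}} ⟩
    y + + suc (suc k)         ≡⟨ x≡ ⟨
    x                         <⟨ x<n ⟩
    + n                       ∎)

module Residue (n : ℕ) .{{_ : ℕ.NonZero n}} where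

  residue : ℤ → ℤ
  residue x = + (x ℤ.%ℕ n)

  residue-nonneg : ∀ x → + 0 ≤ residue x
  residue-nonneg x = +≤+ z≤n

  residue-< : ∀ x → residue x < + n
  residue-< x = +<+ (ℤDivMod.n%ℕd<d x n)

  residue-small : ∀ a → a ℕ.< n → residue (+ a) ≡ + a
  residue-small a a<n = cong +_ (ℕDivMod.m<n⇒m%n≡m a<n)

  residue-0 : residue (+ 0) ≡ + 0
  residue-0 = residue-small 0 (ℕ.>-nonZero⁻¹ n)

  residue-n : residue (+ n) ≡ + 0
  residue-n = cong +_ (ℕDivMod.n%n≡0 n)

  residue-∣ : ∀ x → + n ∣ (residue x - x)
  residue-∣ x = Signed.∣⇒∣ᵤ {+ n} {residue x - x} (Signed.divides (- (x ℤ./ℕ n)) (begin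
    residue x - x                            ≡⟨ cong (λ t → residue x - t) (ℤDivMod.a≡a%ℕn+[a/ℕn]*n x n) ⟩
    residue x - (residue x + (x ℤ./ℕ n) * + n) ≡⟨ cancel (residue x) (x ℤ./ℕ n) (+ n) ⟩
    - (x ℤ./ℕ n) * + n                       ∎))
    where
    open ≡-Reasoning
    cancel : ∀ (r q d : ℤ) → r - (r + q * d) ≡ - q * d
    cancel = solve-∀

  residue-shift : ∀ x y c → y ≡ x + c → + n ∣ (residue y - (residue x + c))
  residue-shift x y c refl =
    subst (+ n ∣_) (regroup (residue (x + c)) (residue x) x c)
      (∣-- {+ n} (residue (x + c) - (x + c)) (residue x - x) (residue-∣ (x + c)) (residue-∣ x))
    where regroup : ∀ (ry rx x c : ℤ) → (ry - (x + c)) - (rx - x) ≡ ry - (rx + c)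
          regroup = solve-∀


-- Reading an integer vector at a natural-number index (0 past the end).
at : ∀ {k} → Vec ℤ k → ℕ → ℤ
at []       _       = + 0
at (x ∷ xs) zero    = x
at (x ∷ xs) (suc i) = at xs i

at-lookup : ∀ {k} (v : Vec ℤ k) (j : Fin k) → at v (toℕ j) ≡ lookup v j
at-lookup (x ∷ v) fz     = refl
at-lookup (x ∷ v) (fs j) = at-lookup v j

weightedSum-cong : ∀ {k} (f : ℕ → ℤ) (u w : Vec ℤ k) → (∀ j → lookup w j ≡ lookup u j) →
                   weightedSum f w ≡ weightedSum f u
weightedSum-cong f []      []      _ = refl
weightedSum-cong f (x ∷ u) (y ∷ w) h =
  cong₂ (λ a b → f 0 * a + b) (h fz) (weightedSum-cong (λ i → f (suc i)) u w (λ j → h (fs j)))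

weightedSum-update₁ : ∀ {k} (f : ℕ → ℤ) (u w : Vec ℤ k) a →
  (∀ j → toℕ j ≢ a → lookup w j ≡ lookup u j) →
  weightedSum f w ≡ weightedSum f u + f a * (at w a - at u a)
weightedSum-update₁ f [] [] a _ = empty (f a)
  where empty : ∀ (c : ℤ) → + 0 ≡ + 0 + c * (+ 0 - + 0)
        empty = solve-∀
weightedSum-update₁ f (x ∷ u) (y ∷ w) zero h
  rewrite weightedSum-cong (λ i → f (suc i)) u w (λ j → h (fs j) (λ ()))
  = shift (f 0) x y _
  where shift : ∀ (c x y s : ℤ) → c * y + s ≡ (c * x + s) + c * (y - x)
        shift = solve-∀
weightedSum-update₁ f (x ∷ u) (y ∷ w) (suc a) h
  rewrite h fz (λ ())
        | weightedSum-update₁ (λ i → f (suc i)) u w a (λ j e → h (fs j) (e ∘ ℕP.suc-injective))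
  = reassoc (f 0) x _ _
  where reassoc : ∀ (c x s t : ℤ) → c * x + (s + t) ≡ (c * x + s) + t
        reassoc = solve-∀

weightedSum-update₂ : ∀ {k} (f : ℕ → ℤ) (u w : Vec ℤ k) a →
  (∀ j → toℕ j ≢ a → toℕ j ≢ suc a → lookup w j ≡ lookup u j) →
  weightedSum f w ≡ weightedSum f u + (f a * (at w a - at u a) + f (suc a) * (at w (suc a) - at u (suc a)))
weightedSum-update₂ f [] [] a _ = empty (f a) (f (suc a))
  where empty : ∀ (c d : ℤ) → + 0 ≡ + 0 + (c * (+ 0 - + 0) + d * (+ 0 - + 0))
        empty = solve-∀
weightedSum-update₂ f (x ∷ u) (y ∷ w) zero h
  rewrite weightedSum-update₁ (λ i → f (suc i)) u w 0 (λ j e → h (fs j) (λ ()) (e ∘ ℕP.suc-injective))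
  = shift (f 0) x y _ _
  where shift : ∀ (c x y s e : ℤ) → c * y + (s + e) ≡ (c * x + s) + (c * (y - x) + e)
        shift = solve-∀
weightedSum-update₂ f (x ∷ u) (y ∷ w) (suc a) h
  rewrite h fz (λ ()) (λ ())
        | weightedSum-update₂ (λ i → f (suc i)) u w a
            (λ j e e′ → h (fs j) (e ∘ ℕP.suc-injective) (e′ ∘ ℕP.suc-injective))
  = reassoc (f 0) x _ _
  where reassoc : ∀ (c x s t : ℤ) → c * x + (s + t) ≡ (c * x + s) + t
        reassoc = solve-∀

weightedSum-complement : ∀ {k} (f g : ℕ → ℤ) (c : ℤ) (v : Vec ℤ k) → (∀ i → i ℕ.< k → f i + g i ≡ c) →
                         weightedSum f v + weightedSum g v ≡ c * zsum v
weightedSum-complement f g c [] _ = sym (ℤP.*-zeroʳ c)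
weightedSum-complement f g c (x ∷ v) h = begin
  (f 0 * x + F) + (g 0 * x + G) ≡⟨ regroup (f 0) (g 0) x F G ⟩
  (f 0 + g 0) * x + (F + G)     ≡⟨ cong₂ (λ a b → a * x + b) (h 0 (s≤s z≤n)) tail ⟩
  c * x + c * zsum v            ≡⟨ ℤP.*-distribˡ-+ c x (zsum v) ⟨
  c * zsum (x ∷ v)              ∎
  where
  open ≡-Reasoning
  F G : ℤ
  F = weightedSum (λ i → f (suc i)) v
  G = weightedSum (λ i → g (suc i)) v
  tail : F + G ≡ c * zsum v
  tail = weightedSum-complement (λ i → f (suc i)) (λ i → g (suc i)) c v (λ i i<k → h (suc i) (s≤s i<k))
  regroup : ∀ (a b x A B : ℤ) → (a * x + A) + (b * x + B) ≡ (a + b) * x + (A + B)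
  regroup = solve-∀

weightedSum-zero : ∀ {k} (f : ℕ → ℤ) → weightedSum f (replicate k (+ 0)) ≡ + 0
weightedSum-zero {zero}  f = refl
weightedSum-zero {suc k} f rewrite weightedSum-zero {k} (λ i → f (suc i)) | ℤP.*-zeroʳ (f 0) = refl

weightedSum-one : ∀ {k} (v : Vec ℤ k) → weightedSum (λ _ → + 1) v ≡ zsum v
weightedSum-one []      = refl
weightedSum-one (x ∷ v) = cong₂ _+_ (ℤP.*-identityˡ x) (weightedSum-one v)

prefix : ∀ {k} → Vec ℤ k → ℕ → ℤ
prefix v p = zsumL (take (suc p) (toList v))

take-step : ∀ {k} (v : Vec ℤ k) p → zsumL (take (suc p) (toList v)) ≡ zsumL (take p (toList v)) + at v p
take-step []      zero    = refl
take-step []      (suc p) = refl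
take-step (x ∷ v) zero    = trans (ℤP.+-identityʳ x) (sym (ℤP.+-identityˡ x))
take-step (x ∷ v) (suc p) =
  trans (cong (λ s → x + s) (take-step v p)) (sym (ℤP.+-assoc x (zsumL (take p (toList v))) (at v p)))

prefix-zero : ∀ {k} (v : Vec ℤ (suc k)) → prefix v 0 ≡ lookup v fz
prefix-zero (x ∷ v) = ℤP.+-identityʳ x

prefix-suc : ∀ {k} (v : Vec ℤ k) p → prefix v (suc p) ≡ prefix v p + at v (suc p)
prefix-suc v p = take-step v (suc p)

zsum-prefix : ∀ {m} (v : V m) → zsum v ≡ prefix v m + at v (suc m)
zsum-prefix {m} v = trans (cong zsumL (sym take-everything)) (prefix-suc v m)
  where take-everything : take (suc (suc m)) (toList v) ≡ toList v
        take-everything = ListP.take-all (suc (suc m)) (toList v) (ℕP.≤-reflexive (VecP.length-toList v))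

_[_]≔_ : (ℕ → ℕ) → ℕ → ℕ → ℕ → ℕ
(T [ q ]≔ x) p with p ℕ.≟ q
... | yes _ = x
... | no  _ = T p

update-at : ∀ T q x → (T [ q ]≔ x) q ≡ x
update-at T q x with q ℕ.≟ q
... | yes _   = refl
... | no  q≢q = ⊥-elim (q≢q refl)

update-other : ∀ T q x p → p ≢ q → (T [ q ]≔ x) p ≡ T p
update-other T q x p p≢q with p ℕ.≟ q
... | yes p≡q = ⊥-elim (p≢q p≡q)
... | no  _   = refl

sumBelow : ℕ → (ℕ → ℕ) → ℕ
sumBelow zero    g = 0
sumBelow (suc k) g = sumBelow k g ℕ.+ g k

sumBelow-cong : ∀ k {g h} → (∀ p → p ℕ.< k → g p ≡ h p) → sumBelow k g ≡ sumBelow k h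
sumBelow-cong zero    _ = refl
sumBelow-cong (suc k) e = cong₂ ℕ._+_ (sumBelow-cong k (λ p p<k → e p (ℕP.m<n⇒m<1+n p<k))) (e k ℕP.≤-refl)

sumBelow-+ : ∀ k g h → sumBelow k g ℕ.+ sumBelow k h ≡ sumBelow k (λ p → g p ℕ.+ h p)
sumBelow-+ zero    g h = refl
sumBelow-+ (suc k) g h =
  trans (interchange (sumBelow k g) (g k) (sumBelow k h) (h k)) (cong (ℕ._+ (g k ℕ.+ h k)) (sumBelow-+ k g h))
  where interchange : ∀ a b c d → (a ℕ.+ b) ℕ.+ (c ℕ.+ d) ≡ (a ℕ.+ c) ℕ.+ (b ℕ.+ d)
        interchange = ℕSolver.solve-∀

sumBelow-const : ∀ k c → sumBelow k (λ _ → c) ≡ k ℕ.* c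
sumBelow-const zero    c = refl
sumBelow-const (suc k) c = trans (cong (ℕ._+ c) (sumBelow-const k c)) (ℕP.+-comm (k ℕ.* c) c)

sumBelow-step : ∀ k {g h} q → q ℕ.< k → g q ≡ suc (h q) → (∀ p → p ℕ.< k → p ≢ q → g p ≡ h p) →
                sumBelow k g ≡ suc (sumBelow k h)
sumBelow-step (suc k) q q<1+k at-q elsewhere with ℕP.m<1+n⇒m<n∨m≡n q<1+k
... | inj₁ q<k  = cong₂ ℕ._+_ (sumBelow-step k q q<k at-q (λ p p<k → elsewhere p (ℕP.m<n⇒m<1+n p<k)))
                              (elsewhere k ℕP.≤-refl (λ k≡q → ℕP.<-irrefl (sym k≡q) q<k))
... | inj₂ refl = trans (cong₂ ℕ._+_ (sumBelow-cong q (λ p p<q → elsewhere p (ℕP.m<n⇒m<1+n p<q) (ℕP.<⇒≢ p<q))) at-q)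
                        (ℕP.+-suc _ _)

extremum : (_≼_ : ℕ → ℕ → Set) → (∀ a b → a ≼ b ⊎ b ≼ a) → (∀ {a} → a ≼ a) →
           (∀ {a b c} → a ≼ b → b ≼ c → a ≼ c) →
           (g : ℕ → ℕ) (k : ℕ) → Σ ℕ λ q → q ℕ.≤ k × (∀ p → p ℕ.≤ k → g q ≼ g p)
extremum _≼_ total ≼-refl ≼-trans g zero = 0 , z≤n , λ { zero _ → ≼-refl }
extremum _≼_ total ≼-refl ≼-trans g (suc k) with extremum _≼_ total ≼-refl ≼-trans g k
... | q , q≤k , least with total (g q) (g (suc k))
...   | inj₁ gq≼ = q , ℕP.m≤n⇒m≤1+n q≤k , λ p p≤1+k → [ least p , (λ { refl → gq≼ }) ]′ (≤-suc-cases p≤1+k)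
...   | inj₂ ≼gq = suc k , ℕP.≤-refl ,
                   λ p p≤1+k → [ (λ p≤k → ≼-trans ≼gq (least p p≤k)) , (λ { refl → ≼-refl }) ]′ (≤-suc-cases p≤1+k)

minimiser : (g : ℕ → ℕ) (k : ℕ) → Σ ℕ λ q → q ℕ.≤ k × (∀ p → p ℕ.≤ k → g q ℕ.≤ g p)
minimiser = extremum ℕ._≤_ ℕP.≤-total ℕP.≤-refl ℕP.≤-trans

maximiser : (g : ℕ → ℕ) (k : ℕ) → Σ ℕ λ q → q ℕ.≤ k × (∀ p → p ℕ.≤ k → g p ℕ.≤ g q)
maximiser = extremum (λ a b → b ℕ.≤ a) (λ a b → ℕP.≤-total b a) ℕP.≤-refl (λ a≥b b≥c → ℕP.≤-trans b≥c a≥b)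

module _ (n m : ℕ) where

  isEnd? : ∀ j → Dec (IsEnd n m j)
  isEnd? j = (toℕ j ℕ.≟ 0) ⊎-dec (toℕ j ℕ.≟ suc m)

  at-inject₁ : (w : V m) (i : Fin (suc m)) → at w (toℕ i) ≡ lookup w (inject₁ i)
  at-inject₁ w i = trans (cong (at w) (sym (FinP.toℕ-inject₁ i))) (at-lookup w (inject₁ i))

  fs-last : (i : Fin (suc m)) → toℕ i ≡ m → fs i ≡ lastIx n m
  fs-last i i≡m = FinP.toℕ-injective (trans (cong suc i≡m) (sym (FinP.toℕ-fromℕ (suc m))))

  inject₁-first : (i : Fin (suc m)) → toℕ i ≡ 0 → inject₁ i ≡ fz
  inject₁-first i i≡0 = FinP.toℕ-injective (trans (FinP.toℕ-inject₁ i) i≡0)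

  fs-end : (i : Fin (suc m)) → IsEnd n m (fs i) → toℕ i ≡ m
  fs-end i (inj₂ e) = ℕP.suc-injective e

  inject₁-end : (i : Fin (suc m)) → IsEnd n m (inject₁ i) → toℕ i ≡ 0
  inject₁-end i (inj₁ e) = trans (sym (FinP.toℕ-inject₁ i)) e
  inject₁-end i (inj₂ e) =
    ⊥-elim (ℕP.<⇒≢ (s≤s (FinP.toℕ≤pred[n] i)) (trans (sym (FinP.toℕ-inject₁ i)) e))

  Shift : Dir n m → Fin (suc m) → V m → V m → Set
  Shift d i u w =
    (∀ j → toℕ j ≢ toℕ i → toℕ j ≢ suc (toℕ i) → lookup w j ≡ lookup u j) ×
    CoordEq n m (inject₁ i) (lookup w (inject₁ i)) (lookup u (inject₁ i) + δ n m d) ×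
    CoordEq n m (fs i) (lookup w (fs i)) (lookup u (fs i) - δ n m d)

  weightedSum-shift : ∀ {d i u w} (f : ℕ → ℤ) → Shift d i u w →
    weightedSum f w ≡ weightedSum f u + (f (toℕ i) * (lookup w (inject₁ i) - lookup u (inject₁ i))
                                         + f (suc (toℕ i)) * (lookup w (fs i) - lookup u (fs i)))
  weightedSum-shift {i = i} {u} {w} f (same , _)
    rewrite weightedSum-update₂ f u w (toℕ i) same
          | at-inject₁ w i | at-inject₁ u i | at-lookup w (fs i) | at-lookup u (fs i) = refl

  ∣-self : ∀ b → + n ∣ (b - b)
  ∣-self b = subst (+ n ∣_) (sym (ℤP.+-inverseʳ b)) (∣-0 {+ n})

  coordEq-exact : ∀ {j a b} → a ≡ b → CoordEq n m j a b
  coordEq-exact {b = b} refl = (λ _ → ∣-self b) , (λ _ → refl)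

  coordEq-end : ∀ {j a b} → IsEnd n m j → + n ∣ (a - b) → CoordEq n m j a b
  coordEq-end end n∣ = (λ _ → n∣) , (λ inner → ⊥-elim (inner end))

  coordEq-∣ : ∀ {j a b} → CoordEq n m j a b → + n ∣ (a - b)
  coordEq-∣ {j} {b = b} (congruent , exact) with isEnd? j
  ... | yes end   = congruent end
  ... | no inner  rewrite exact inner = ∣-self b

  coordEq-flip : ∀ {j a b e} → CoordEq n m j a (b + e) → CoordEq n m j b (a - e)
  coordEq-flip {j} {a} {b} {e} (congruent , exact) =
    (λ end → subst (+ n ∣_) (negate a b e) (∣-- {+ n} (+ 0) (a - (b + e)) (∣-0 {+ n}) (congruent end))) ,
    (λ inner → trans (sym (undo b e)) (cong (_- e) (sym (exact inner))))
    where
    negate : ∀ (a b e : ℤ) → + 0 - (a - (b + e)) ≡ b - (a - e)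
    negate = solve-∀
    undo : ∀ (b e : ℤ) → b + e - e ≡ b
    undo = solve-∀

  shift-sum : ∀ {d i u w} → Shift d i u w → + n ∣ (zsum w - zsum u)
  shift-sum {d} {i} {u} {w} (same , left , right) =
    subst (+ n ∣_) (sym total)
      (∣-+ {+ n} (wl - (ul + δ n m d)) (wr - (ur - δ n m d)) (coordEq-∣ {inject₁ i} left) (coordEq-∣ {fs i} right))
    where
    wl ul wr ur : ℤ
    wl = lookup w (inject₁ i)
    ul = lookup u (inject₁ i)
    wr = lookup w (fs i)
    ur = lookup u (fs i)
    regroup : ∀ (S wl ul wr ur e : ℤ) →
              S + (+ 1 * (wl - ul) + + 1 * (wr - ur)) - S ≡ (wl - (ul + e)) + (wr - (ur - e))
    regroup = solve-∀
    total : zsum w - zsum u ≡ (wl - (ul + δ n m d)) + (wr - (ur - δ n m d))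
    total = begin
      zsum w - zsum u
        ≡⟨ cong₂ _-_ (weightedSum-one w) (weightedSum-one u) ⟨
      weightedSum (λ _ → + 1) w - weightedSum (λ _ → + 1) u
        ≡⟨ cong (_- weightedSum (λ _ → + 1) u)
                (weightedSum-shift {d} {i} {u} {w} (λ _ → + 1) (same , left , right)) ⟩
      weightedSum (λ _ → + 1) u + (+ 1 * (wl - ul) + + 1 * (wr - ur)) - weightedSum (λ _ → + 1) u
        ≡⟨ regroup (weightedSum (λ _ → + 1) u) wl ul wr ur (δ n m d) ⟩
      (wl - (ul + δ n m d)) + (wr - (ur - δ n m d)) ∎
      where open ≡-Reasoning

  shift-∣ : ∀ {d i u w} → Shift d i u w → (+ n ∣ zsum u) ⊎ (+ n ∣ zsum w) → (+ n ∣ zsum u) × (+ n ∣ zsum w)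
  shift-∣ {d} {i} {u} {w} sh (inj₁ n∣u) =
    n∣u , subst (+ n ∣_) (back (zsum w) (zsum u))
                (∣-+ {+ n} (zsum w - zsum u) (zsum u) (shift-sum {d} {i} {u} {w} sh) n∣u)
    where back : ∀ (W U : ℤ) → W - U + U ≡ W
          back = solve-∀
  shift-∣ {d} {i} {u} {w} sh (inj₂ n∣w) =
    subst (+ n ∣_) (back (zsum w) (zsum u))
          (∣-- {+ n} (zsum w) (zsum w - zsum u) n∣w (shift-sum {d} {i} {u} {w} sh)) , n∣w
    where back : ∀ (W U : ℤ) → W - (W - U) ≡ U
          back = solve-∀

  flip-move : ∀ {i u w} → Move n m L i u w → Move n m R i w u
  flip-move {i} (vu , vw , same , left , right) =
    vw , vu , (λ j j≢i j≢i+1 → sym (same j j≢i j≢i+1)) ,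
    coordEq-flip {inject₁ i} left , coordEq-flip {fs i} right


  weighted-shift : ∀ {j x y e} (c : ℤ) → (IsEnd n m j → c ≡ + 0) → CoordEq n m j y (x + e) →
                   c * (y - x) ≡ c * e
  weighted-shift {j} {x} {y} {e} c weight0 (_ , exact) with isEnd? j
  ... | yes end rewrite weight0 end = trans (ℤP.*-zeroˡ (y - x)) (sym (ℤP.*-zeroˡ e))
  ... | no inner = cong (c *_) (trans (cong (_- x) (exact inner)) (cancel x e))
    where cancel : ∀ (x e : ℤ) → x + e - x ≡ e
          cancel = solve-∀

  interior-excess : ∀ {j x y} → ¬ IsEnd n m j → CoordEq n m j y x → + 0 ≤ y - x
  interior-excess {x = x} inner (_ , exact) rewrite exact inner = ℤP.≤-reflexive (sym (ℤP.+-inverseʳ x))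

  -- Unless the move is →s_m, the entry i+1 ends no lower than an exact shift by -δ puts it:
  -- the only way to drop further is to wrap the last entry around from 0 to n-1.
  excessʳ-nonneg : ∀ {d i u w} → Move n m d i u w → ¬ (d ≡ R × toℕ i ≡ m) →
                   + 0 ≤ lookup w (fs i) - (lookup u (fs i) - δ n m d)
  excessʳ-nonneg {d} {i} mv not-last with isEnd? (fs i)
  excessʳ-nonneg {d} {i} (_ , _ , _ , _ , ce) not-last | no inner = interior-excess inner ce
  excessʳ-nonneg {R} {i} mv not-last | yes end = ⊥-elim (not-last (refl , fs-end i end))
  excessʳ-nonneg {L} {i} {u} {w} (vu , vw , _ , _ , (wrap , _)) _ | yes end =
    wrap-down (subst (λ k → + 0 ≤ lookup w k) last (proj₁ (proj₁ (proj₂ vw))))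
              (subst (λ k → lookup u k < + n) last (proj₂ (proj₁ (proj₂ vu))))
              (wrap end)
    where last : lastIx n m ≡ fs i
          last = sym (fs-last i (fs-end i end))

  excessˡ-nonneg : ∀ {d i u w} → Move n m d i u w → ¬ (d ≡ L × toℕ i ≡ 0) →
                   + 0 ≤ lookup w (inject₁ i) - (lookup u (inject₁ i) + δ n m d)
  excessˡ-nonneg {d} {i} mv not-first with isEnd? (inject₁ i)
  excessˡ-nonneg {d} {i} (_ , _ , _ , ce , _) not-first | no inner = interior-excess inner ce
  excessˡ-nonneg {L} {i} mv not-first | yes end = ⊥-elim (not-first (refl , inject₁-end i end))
  excessˡ-nonneg {R} {i} {u} {w} (vu , vw , _ , (wrap , _) , _) _ | yes end =
    wrap-down (subst (λ k → + 0 ≤ lookup w k) first (proj₁ (proj₁ vw)))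
              (subst (λ k → lookup u k < + n) first (proj₂ (proj₁ vu)))
              (wrap end)
    where first : fz ≡ inject₁ i
          first = sym (inject₁-first i (inject₁-end i end))

  Φ Ψ : V m → ℤ
  Φ = weightedSum (λ i → + i)
  Ψ = weightedSum (λ i → + (suc m ℕ.∸ i))

  -- Every move except →s_m lowers Φ by at most one: the gain Φ(w) + 1 - Φ(u) equals
  -- (i+1)·(excess at i+1) + (1 - δ), and both terms are nonnegative.
  Φ-step : ∀ {d i u w} → Move n m d i u w → ¬ (d ≡ R × toℕ i ≡ m) → Φ u ≤ + 1 + Φ w
  Φ-step {d} {i} {u} {w} mv@(_ , _ , _ , ce , _) not-last = begin
    Φ u                                       ≤⟨ ≤-+-nonneg (Φ u) gain-nonneg ⟩
    Φ u + (+ suc a * excess + (+ 1 - δ n m d)) ≡⟨ gain ⟨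
    + 1 + Φ w                                 ∎
    where
    open ℤP.≤-Reasoning
    a : ℕ
    a = toℕ i
    excess : ℤ
    excess = lookup w (fs i) - (lookup u (fs i) - δ n m d)
    gain-nonneg : + 0 ≤ + suc a * excess + (+ 1 - δ n m d)
    gain-nonneg =
      ℤP.+-mono-≤ (*-nonneg {+ suc a} (+≤+ z≤n) (excessʳ-nonneg {d} {i} {u} {w} mv not-last)) (one-minus-δ d)
      where one-minus-δ : ∀ d → + 0 ≤ + 1 - δ n m d
            one-minus-δ L = +≤+ z≤n
            one-minus-δ R = +≤+ z≤n
    left-weight : IsEnd n m (inject₁ i) → + a ≡ + 0
    left-weight end = cong +_ (inject₁-end i end)
    regroup : ∀ (P A d wr ur : ℤ) →
      + 1 + (P + (A * d + (+ 1 + A) * (wr - ur))) ≡ P + ((+ 1 + A) * (wr - (ur - d)) + (+ 1 - d))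
    regroup = solve-∀
    Δl Δr : ℤ
    Δl = lookup w (inject₁ i) - lookup u (inject₁ i)
    Δr = lookup w (fs i) - lookup u (fs i)
    gain : + 1 + Φ w ≡ Φ u + (+ suc a * excess + (+ 1 - δ n m d))
    gain = ≡.begin
      + 1 + Φ w
        ≡.≡⟨ cong (λ t → + 1 + t) (weightedSum-shift {d} {i} {u} {w} (λ i → + i) (proj₂ (proj₂ mv))) ⟩
      + 1 + (Φ u + (+ a * Δl + + suc a * Δr))
        ≡.≡⟨ cong (λ t → + 1 + (Φ u + (t + + suc a * Δr))) (weighted-shift {inject₁ i} (+ a) left-weight ce) ⟩
      + 1 + (Φ u + (+ a * δ n m d + + suc a * Δr))
        ≡.≡⟨ regroup (Φ u) (+ a) (δ n m d) (lookup w (fs i)) (lookup u (fs i)) ⟩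
      Φ u + (+ suc a * excess + (+ 1 - δ n m d))
        ≡.∎
      where module ≡ = ≡-Reasoning

  -- Dually, every move except ←s_0 lowers Ψ by at most one: the gain Ψ(w) + 1 - Ψ(u)
  -- equals (m+1-i)·(excess at i) + (1 + δ).
  Ψ-step : ∀ {d i u w} → Move n m d i u w → ¬ (d ≡ L × toℕ i ≡ 0) → Ψ u ≤ + 1 + Ψ w
  Ψ-step {d} {i} {u} {w} mv@(_ , _ , _ , _ , ce) not-first = begin
    Ψ u                                              ≤⟨ ≤-+-nonneg (Ψ u) gain-nonneg ⟩
    Ψ u + ((+ 1 + + b) * excess + (+ 1 + δ n m d))   ≡⟨ gain ⟨
    + 1 + Ψ w                                        ∎
    where
    open ℤP.≤-Reasoning
    a b : ℕ
    a = toℕ i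
    b = m ℕ.∸ a
    excess : ℤ
    excess = lookup w (inject₁ i) - (lookup u (inject₁ i) + δ n m d)
    gain-nonneg : + 0 ≤ (+ 1 + + b) * excess + (+ 1 + δ n m d)
    gain-nonneg =
      ℤP.+-mono-≤ (*-nonneg {+ 1 + + b} (+≤+ z≤n) (excessˡ-nonneg {d} {i} {u} {w} mv not-first)) (one-plus-δ d)
      where one-plus-δ : ∀ d → + 0 ≤ + 1 + δ n m d
            one-plus-δ L = +≤+ z≤n
            one-plus-δ R = +≤+ z≤n
    left-weight : + (suc m ℕ.∸ a) ≡ + 1 + + b
    left-weight = cong +_ (ℕP.+-∸-assoc 1 (FinP.toℕ≤pred[n] i))
    right-weight : IsEnd n m (fs i) → + b ≡ + 0
    right-weight end = cong +_ (trans (cong (m ℕ.∸_) (fs-end i end)) (ℕP.n∸n≡0 m))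
    regroup : ∀ (P B d wl ul : ℤ) →
      + 1 + (P + ((+ 1 + B) * (wl - ul) + B * - d)) ≡ P + ((+ 1 + B) * (wl - (ul + d)) + (+ 1 + d))
    regroup = solve-∀
    Δl Δr : ℤ
    Δl = lookup w (inject₁ i) - lookup u (inject₁ i)
    Δr = lookup w (fs i) - lookup u (fs i)
    gain : + 1 + Ψ w ≡ Ψ u + ((+ 1 + + b) * excess + (+ 1 + δ n m d))
    gain = ≡.begin
      + 1 + Ψ w
        ≡.≡⟨ cong (λ t → + 1 + t) (weightedSum-shift {d} {i} {u} {w} (λ i → + (suc m ℕ.∸ i)) (proj₂ (proj₂ mv))) ⟩
      + 1 + (Ψ u + (+ (suc m ℕ.∸ a) * Δl + + b * Δr))
        ≡.≡⟨ cong₂ (λ s t → + 1 + (Ψ u + (s * Δl + t))) left-weight (weighted-shift {fs i} (+ b) right-weight ce) ⟩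
      + 1 + (Ψ u + ((+ 1 + + b) * Δl + + b * - δ n m d))
        ≡.≡⟨ regroup (Ψ u) (+ b) (δ n m d) (lookup w (inject₁ i)) (lookup u (inject₁ i)) ⟩
      Ψ u + ((+ 1 + + b) * excess + (+ 1 + δ n m d))
        ≡.∎
      where module ≡ = ≡-Reasoning

  Φ-lowerBound : ∀ {u ws} → Path n m u (zeroV n m) ws → ¬ ((R , fromℕ m) ∈ ws) → Φ u ≤ + length ws
  Φ-lowerBound nil _ = ℤP.≤-reflexive (weightedSum-zero {suc (suc m)} (λ i → + i))
  Φ-lowerBound {u} (cons {v = v} {d = d} {i = i} mv path) no-last =
    ℤP.≤-trans (Φ-step {d} {i} {u} {v} mv not-last) (ℤP.+-monoʳ-≤ (+ 1) (Φ-lowerBound path (no-last ∘ there)))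
    where
    not-last : ¬ (d ≡ R × toℕ i ≡ m)
    not-last (refl , i≡m) = no-last (here (cong (R ,_) (FinP.toℕ-injective (trans (FinP.toℕ-fromℕ m) (sym i≡m)))))

  Ψ-lowerBound : ∀ {u ws} → Path n m u (zeroV n m) ws → ¬ ((L , fz) ∈ ws) → Ψ u ≤ + length ws
  Ψ-lowerBound nil _ = ℤP.≤-reflexive (weightedSum-zero {suc (suc m)} (λ i → + (suc m ℕ.∸ i)))
  Ψ-lowerBound {u} (cons {v = v} {d = d} {i = i} mv path) no-first =
    ℤP.≤-trans (Ψ-step {d} {i} {u} {v} mv not-first) (ℤP.+-monoʳ-≤ (+ 1) (Ψ-lowerBound path (no-first ∘ there)))
    where
    not-first : ¬ (d ≡ L × toℕ i ≡ 0)
    not-first (refl , i≡0) = no-first (here (cong (L ,_) (FinP.toℕ-injective {i = fz} {j = i} (sym i≡0))))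


-- A profile T : ℕ → ℕ (only T 0, …, T m matter) encodes the candidate vertex whose interior
-- entries are the increments of T and whose end entries are T 0 and n - T m reduced mod n.
-- A vertex without pivots in [0, m] is encoded by its prefix sums, and raising the profile by
-- one at q is the move ←s_q.
module _ (n m : ℕ) .{{_ : ℕ.NonZero n}} where
  open Residue n

  entry : (ℕ → ℕ) → ℕ → ℤ
  entry T zero = residue (+ T 0)
  entry T (suc k) with k ℕ.<? m
  ... | yes _ = + T (suc k) - + T k
  ... | no  _ = residue (+ n - + T k)

  vertexOf : (ℕ → ℕ) → V m
  vertexOf T = tabulate (λ j → entry T (toℕ j))

  lookup-vertexOf : ∀ T j → lookup (vertexOf T) j ≡ entry T (toℕ j)
  lookup-vertexOf T = VecP.lookup∘tabulate (λ j → entry T (toℕ j))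

  entry-inner : ∀ T k → k ℕ.< m → entry T (suc k) ≡ + T (suc k) - + T k
  entry-inner T k k<m with k ℕ.<? m
  ... | yes _   = refl
  ... | no  k≮m = ⊥-elim (k≮m k<m)

  entry-last : ∀ T → entry T (suc m) ≡ residue (+ n - + T m)
  entry-last T with m ℕ.<? m
  ... | yes m<m = ⊥-elim (ℕP.<-irrefl refl m<m)
  ... | no  _   = refl

  entry-cong : ∀ {T T'} k → T' k ≡ T k → (∀ k' → k ≡ suc k' → T' k' ≡ T k') → entry T' k ≡ entry T k
  entry-cong zero    at-k _ = cong (residue ∘ +_) at-k
  entry-cong (suc k) at-k before with k ℕ.<? m
  ... | yes _ = cong₂ (λ x y → + x - + y) at-k (before k refl)
  ... | no  _ = cong (λ x → residue (+ n - + x)) (before k refl)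

  record Admissible (T : ℕ → ℕ) : Set where
    field
      bounded   : ∀ p → p ℕ.≤ m → T p ℕ.≤ n
      lipschitz : ∀ p → p ℕ.< m → T p ≈₁ T (suc p)
  open Admissible

  vertexOf-isVertex : ∀ {T} → Admissible T → + n ∣ zsum (vertexOf T) → IsVertex n m (vertexOf T)
  vertexOf-isVertex {T} adm n∣sum =
    (residue-nonneg (+ T 0) , residue-< (+ T 0)) ,
    (subst (+ 0 ≤_) (sym last) (residue-nonneg (+ n - + T m)) ,
     subst (_< + n) (sym last) (residue-< (+ n - + T m))) ,
    inner , n∣sum
    where
    last : lookup (vertexOf T) (lastIx n m) ≡ residue (+ n - + T m)
    last = trans (lookup-vertexOf T (lastIx n m))
                 (trans (cong (entry T) (FinP.toℕ-fromℕ (suc m))) (entry-last T))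
    inner : ∀ (j : Fin m) → -1ℤ ≤ lookup (vertexOf T) (fs (inject₁ j)) × lookup (vertexOf T) (fs (inject₁ j)) ≤ + 1
    inner j rewrite lookup-vertexOf T (fs (inject₁ j)) | FinP.toℕ-inject₁ j
                  | entry-inner T (toℕ j) (FinP.toℕ<n j) =
      increment-bounds (lipschitz adm (toℕ j) (FinP.toℕ<n j))

  RaisedAt : (ℕ → ℕ) → ℕ → (ℕ → ℕ) → Set
  RaisedAt T q T' = T' q ≡ suc (T q) × (∀ p → p ≢ q → T' p ≡ T p)

  raise-left : ∀ {T T'} a → RaisedAt T a T' → a ℕ.≤ m → ∀ j → toℕ j ≡ a →
               CoordEq n m j (entry T' a) (entry T a + + 1)
  raise-left {T} {T'} zero (up , _) _ j j≡0 =
    coordEq-end n m (inj₁ j≡0) (residue-shift (+ T 0) (+ T' 0) (+ 1) (trans (cong +_ up) (+suc (T 0))))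
  raise-left {T} {T'} (suc k) (up , same) k<m _ _ = coordEq-exact n m (begin
    entry T' (suc k)              ≡⟨ entry-inner T' k k<m ⟩
    + T' (suc k) - + T' k         ≡⟨ cong₂ (λ x y → + x - + y) up (same k (ℕP.<⇒≢ (ℕP.n<1+n k))) ⟩
    + suc (T (suc k)) - + T k     ≡⟨ cong (_- + T k) (+suc (T (suc k))) ⟩
    + T (suc k) + + 1 - + T k     ≡⟨ swap (+ T (suc k)) (+ T k) ⟩
    (+ T (suc k) - + T k) + + 1   ≡⟨ cong (_+ + 1) (entry-inner T k k<m) ⟨
    entry T (suc k) + + 1         ∎)
    where
    open ≡-Reasoning
    swap : ∀ (x y : ℤ) → x + + 1 - y ≡ (x - y) + + 1
    swap = solve-∀

  raise-right : ∀ {T T'} a → RaisedAt T a T' → a ℕ.≤ m → ∀ j → toℕ j ≡ suc a →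
                CoordEq n m j (entry T' (suc a)) (entry T (suc a) - + 1)
  raise-right {T} {T'} a r a≤m j j≡1+a with ℕP.m≤n⇒m<n∨m≡n a≤m
  raise-right {T} {T'} a (up , same) _ _ _ | inj₁ a<m = coordEq-exact n m (begin
    entry T' (suc a)              ≡⟨ entry-inner T' a a<m ⟩
    + T' (suc a) - + T' a         ≡⟨ cong₂ (λ x y → + x - + y) (same (suc a) (ℕP.<⇒≢ (ℕP.n<1+n a) ∘ sym)) up ⟩
    + T (suc a) - + suc (T a)     ≡⟨ cong (λ y → + T (suc a) - y) (+suc (T a)) ⟩
    + T (suc a) - (+ T a + + 1)   ≡⟨ regroup (+ T (suc a)) (+ T a) ⟩
    (+ T (suc a) - + T a) - + 1   ≡⟨ cong (_- + 1) (entry-inner T a a<m) ⟨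
    entry T (suc a) - + 1         ∎)
    where
    open ≡-Reasoning
    regroup : ∀ (x y : ℤ) → x - (y + + 1) ≡ (x - y) - + 1
    regroup = solve-∀
  raise-right {T} {T'} a (up , _) _ j j≡1+a | inj₂ refl =
    subst₂ (λ x y → CoordEq n m j x (y - + 1)) (sym (entry-last T')) (sym (entry-last T))
      (coordEq-end n m (inj₂ j≡1+a)
        (residue-shift (+ n - + T a) (+ n - + T' a) (- + 1)
          (trans (cong (λ y → + n - y) (trans (cong +_ up) (+suc (T a)))) (regroup (+ n) (+ T a)))))
    where
    regroup : ∀ (x y : ℤ) → x - (y + + 1) ≡ x - y + - + 1
    regroup = solve-∀

  raise-same : ∀ {T T'} a → RaisedAt T a T' → ∀ k → k ≢ a → k ≢ suc a → entry T' k ≡ entry T k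
  raise-same a (_ , same) k k≢a k≢1+a =
    entry-cong k (same k k≢a) (λ k' k≡1+k' → same k' (λ k'≡a → k≢1+a (trans k≡1+k' (cong suc k'≡a))))

  raise-shift : ∀ {T T'} (q : Fin (suc m)) → RaisedAt T (toℕ q) T' → Shift n m L q (vertexOf T) (vertexOf T')
  raise-shift {T} {T'} q r =
    (λ j j≢q j≢1+q → begin
      lookup (vertexOf T') j ≡⟨ lookup-vertexOf T' j ⟩
      entry T' (toℕ j)       ≡⟨ raise-same (toℕ q) r (toℕ j) j≢q j≢1+q ⟩
      entry T (toℕ j)        ≡⟨ lookup-vertexOf T j ⟨
      lookup (vertexOf T) j  ∎) ,
    subst₂ (λ x y → CoordEq n m (inject₁ q) x (y + + 1)) (sym (lookup-inject₁ T')) (sym (lookup-inject₁ T))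
      (raise-left (toℕ q) r q≤m (inject₁ q) (FinP.toℕ-inject₁ q)) ,
    subst₂ (λ x y → CoordEq n m (fs q) x (y - + 1)) (sym (lookup-vertexOf T' (fs q))) (sym (lookup-vertexOf T (fs q)))
      (raise-right (toℕ q) r q≤m (fs q) refl)
    where
    open ≡-Reasoning
    q≤m : toℕ q ℕ.≤ m
    q≤m = FinP.toℕ≤pred[n] q
    lookup-inject₁ : ∀ S → lookup (vertexOf S) (inject₁ q) ≡ entry S (toℕ q)
    lookup-inject₁ S = trans (lookup-vertexOf S (inject₁ q)) (cong (entry S) (FinP.toℕ-inject₁ q))

  raise-move : ∀ {T T'} (q : Fin (suc m)) → Admissible T → Admissible T' → RaisedAt T (toℕ q) T' →
               (+ n ∣ zsum (vertexOf T)) ⊎ (+ n ∣ zsum (vertexOf T')) → Move n m L q (vertexOf T) (vertexOf T')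
  raise-move {T} {T'} q adm adm' r one-divisible =
    vertexOf-isVertex adm (proj₁ both) , vertexOf-isVertex adm' (proj₂ both) , shift
    where
    shift : Shift n m L q (vertexOf T) (vertexOf T')
    shift = raise-shift q r
    both : (+ n ∣ zsum (vertexOf T)) × (+ n ∣ zsum (vertexOf T'))
    both = shift-∣ n m {L} {q} {vertexOf T} {vertexOf T'} shift one-divisible

  vertexOf-≡ : ∀ T (v : V m) → (∀ j → entry T (toℕ j) ≡ lookup v j) → vertexOf T ≡ v
  vertexOf-≡ T v h = trans (VecP.tabulate-cong h) (VecP.tabulate∘lookup v)

  vertexOf-constant : ∀ T c → (∀ p → p ℕ.≤ m → T p ≡ c) → residue (+ c) ≡ + 0 → residue (+ n - + c) ≡ + 0 →
                      vertexOf T ≡ zeroV n m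
  vertexOf-constant T c const first-zero last-zero =
    vertexOf-≡ T (zeroV n m) (λ j → trans (zero-entry (toℕ j) (FinP.toℕ≤pred[n] j))
                                         (sym (VecP.lookup-replicate j (+ 0))))
    where
    zero-entry : ∀ k → k ℕ.≤ suc m → entry T k ≡ + 0
    zero-entry zero _ = trans (cong (residue ∘ +_) (const 0 z≤n)) first-zero
    zero-entry (suc k) k<1+m with ℕP.m≤n⇒m<n∨m≡n (ℕP.≤-pred k<1+m)
    ... | inj₁ k<m  = trans (entry-inner T k k<m)
                        (trans (cong₂ (λ x y → + x - + y) (const (suc k) k<m) (const k (ℕP.<⇒≤ k<m)))
                               (ℤP.+-inverseʳ (+ c)))
    ... | inj₂ refl = trans (entry-last T) (trans (cong (λ x → residue (+ n - + x)) (const k ℕP.≤-refl)) last-zero)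


module _ (n m : ℕ) .{{_ : ℕ.NonZero n}} where
  open Admissible

  update-admissible : ∀ {T q x} → Admissible n m T → x ℕ.≤ n →
    (∀ p → p ℕ.< m → suc p ≡ q → T p ≈₁ x) → (∀ p → p ℕ.< m → p ≡ q → x ≈₁ T (suc p)) →
    Admissible n m (T [ q ]≔ x)
  update-admissible {T} {q} {x} adm x≤n left right = record { bounded = bounded′ ; lipschitz = lipschitz′ }
    where
    bounded′ : ∀ p → p ℕ.≤ m → (T [ q ]≔ x) p ℕ.≤ n
    bounded′ p p≤m with p ℕ.≟ q
    ... | yes _ = x≤n
    ... | no  _ = bounded adm p p≤m
    lipschitz′ : ∀ p → p ℕ.< m → (T [ q ]≔ x) p ≈₁ (T [ q ]≔ x) (suc p)
    lipschitz′ p p<m with p ℕ.≟ q | suc p ℕ.≟ q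
    ... | yes p≡q | yes 1+p≡q = ⊥-elim (ℕP.<⇒≢ (ℕP.n<1+n p) (trans p≡q (sym 1+p≡q)))
    ... | yes p≡q | no  _     = right p p<m p≡q
    ... | no  _   | yes 1+p≡q = left p p<m 1+p≡q
    ... | no  _   | no  _     = lipschitz adm p p<m

  raise-admissible : ∀ {T q} → Admissible n m T → T q ℕ.< n → (∀ p → p ℕ.≤ m → T q ℕ.≤ T p) →
                     Admissible n m (T [ q ]≔ suc (T q))
  raise-admissible {T} {q} adm Tq<n least = update-admissible adm Tq<n left right
    where
    left : ∀ p → p ℕ.< m → suc p ≡ q → T p ≈₁ suc (T q)
    left p p<m refl = ℕP.m≤n⇒m≤1+n (proj₁ (lipschitz adm p p<m)) , s≤s (least p (ℕP.<⇒≤ p<m))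
    right : ∀ p → p ℕ.< m → p ≡ q → suc (T q) ≈₁ T (suc p)
    right p p<m refl = s≤s (least (suc p) p<m) , ℕP.m≤n⇒m≤1+n (proj₂ (lipschitz adm p p<m))

  lower-admissible : ∀ {T q} → Admissible n m T → q ℕ.≤ m → (∀ p → p ℕ.≤ m → T p ℕ.≤ T q) →
                     Admissible n m (T [ q ]≔ ℕ.pred (T q))
  lower-admissible {T} {q} adm q≤m greatest =
    update-admissible adm (ℕP.≤-trans ℕP.pred[n]≤n (bounded adm q q≤m)) left right
    where
    left : ∀ p → p ℕ.< m → suc p ≡ q → T p ≈₁ ℕ.pred (T q)
    left p p<m refl = ℕP.≤-trans (greatest p (ℕP.<⇒≤ p<m)) (≤-suc-pred (T q)) ,
                      ℕP.≤-trans ℕP.pred[n]≤n (proj₂ (lipschitz adm p p<m))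
    right : ∀ p → p ℕ.< m → p ≡ q → ℕ.pred (T q) ≈₁ T (suc p)
    right p p<m refl = ℕP.≤-trans ℕP.pred[n]≤n (proj₁ (lipschitz adm p p<m)) ,
                       ℕP.≤-trans (greatest (suc p) p<m) (≤-suc-pred (T q))

  -- μ↑ T = Σ_{p ≤ m} (n - T p) counts the raises needed to reach the constant profile n,
  -- μ↓ T = Σ_{p ≤ m} T p the lowerings needed to reach the constant profile 0.
  μ↑ μ↓ : (ℕ → ℕ) → ℕ
  μ↑ T = sumBelow (suc m) (λ p → n ℕ.∸ T p)
  μ↓ T = sumBelow (suc m) T

  Good : (ℕ → ℕ) → Set
  Good T = Admissible n m T × + n ∣ zsum (vertexOf n m T)

  Step : Dir n m → ((ℕ → ℕ) → ℕ) → (ℕ → ℕ) → Set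
  Step d μ T = (vertexOf n m T ≡ zeroV n m × μ T ≡ 0) ⊎
               Σ (ℕ → ℕ) λ T' → Σ (Fin (suc m)) λ q →
                 Move n m d q (vertexOf n m T) (vertexOf n m T') × Good T' × μ T ≡ suc (μ T')

  Descent : Dir n m → ((ℕ → ℕ) → ℕ) → (ℕ → ℕ) → Set
  Descent d μ T = Σ (List (Label n m)) λ ws →
    Path n m (vertexOf n m T) (zeroV n m) ws × length ws ≡ μ T × All (λ l → proj₁ l ≡ d) ws

  descend : ∀ d μ → (∀ T → Good T → Step d μ T) → ∀ T → Good T → Descent d μ T
  descend d μ step T good = go (μ T) T refl good
    where
    go : ∀ k T → μ T ≡ k → Good T → Descent d μ T
    go k T μT≡k good with step T good
    ... | inj₁ (at-zero , μT≡0) = [] , subst (λ u → Path n m u (zeroV n m) []) (sym at-zero) nil , sym μT≡0 , []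
    go zero    T μT≡0 good | inj₂ (_ , _ , _ , _ , μT≡1+) = ⊥-elim (ℕP.0≢1+n (trans (sym μT≡0) μT≡1+))
    go (suc k) T μT≡1+k good | inj₂ (T' , q , mv , good' , μT≡1+)
      with go k T' (ℕP.suc-injective (trans (sym μT≡1+) μT≡1+k)) good'
    ... | ws , path , length≡ , all-d =
      (d , q) ∷ ws , cons mv path , trans (cong suc length≡) (sym μT≡1+) , refl ∷ all-d

  private
    target-∣ : ∀ {d i u w} → Move n m d i u w → + n ∣ zsum w
    target-∣ (_ , (_ , _ , _ , n∣w) , _) = n∣w

    index : ∀ q → q ℕ.≤ m → Σ (Fin (suc m)) λ i → toℕ i ≡ q
    index q q≤m = fromℕ< (s≤s q≤m) , FinP.toℕ-fromℕ< (s≤s q≤m)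

  raise-step : ∀ T → Good T → Step L μ↑ T
  raise-step T (adm , n∣T) with minimiser T m
  ... | q , q≤m , least with T q ℕ.<? n
  ...   | no Tq≮n = inj₁ (vertexOf-constant n m T n all-n residue-n last-zero , measure-zero)
    where
    open Residue n
    all-n : ∀ p → p ℕ.≤ m → T p ≡ n
    all-n p p≤m = ℕP.≤-antisym (bounded adm p p≤m) (ℕP.≤-trans (ℕP.≮⇒≥ Tq≮n) (least p p≤m))
    last-zero : residue (+ n - + n) ≡ + 0
    last-zero = trans (cong residue (ℤP.+-inverseʳ (+ n))) residue-0
    measure-zero : μ↑ T ≡ 0
    measure-zero = trans (sumBelow-cong (suc m) (λ p p<1+m → trans (cong (n ℕ.∸_) (all-n p (ℕP.≤-pred p<1+m)))
                                                                    (ℕP.n∸n≡0 n)))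
                         (trans (sumBelow-const (suc m) 0) (ℕP.*-zeroʳ (suc m)))
  ...   | yes Tq<n =
    inj₂ (T' , i , mv , (adm' , target-∣ {L} {i} {vertexOf n m T} {vertexOf n m T'} mv) , measure-step)
    where
    T' : ℕ → ℕ
    T' = T [ q ]≔ suc (T q)
    i : Fin (suc m)
    i = proj₁ (index q q≤m)
    adm' : Admissible n m T'
    adm' = raise-admissible adm Tq<n least
    raised : RaisedAt n m T (toℕ i) T'
    raised = subst (λ a → RaisedAt n m T a T') (sym (proj₂ (index q q≤m)))
                   (update-at T q (suc (T q)) , λ p p≢q → update-other T q (suc (T q)) p p≢q)
    mv : Move n m L i (vertexOf n m T) (vertexOf n m T')
    mv = raise-move n m i adm adm' raised (inj₁ n∣T)
    measure-step : μ↑ T ≡ suc (μ↑ T')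
    measure-step = sumBelow-step (suc m) q (s≤s q≤m)
      (trans (∸-step Tq<n) (cong (λ x → suc (n ℕ.∸ x)) (sym (update-at T q (suc (T q))))))
      (λ p _ p≢q → cong (n ℕ.∸_) (sym (update-other T q (suc (T q)) p p≢q)))

  -- Lowering a maximum of the profile is a step →s towards the constant profile 0: it is the
  -- reverse of raising the lowered profile back.
  lower-step : ∀ T → Good T → Step R μ↓ T
  lower-step T (adm , n∣T) with maximiser T m
  ... | q , q≤m , greatest with T q ℕ.≟ 0
  ...   | yes Tq≡0 = inj₁ (vertexOf-constant n m T 0 all-0 residue-0 last-zero , measure-zero)
    where
    open Residue n
    all-0 : ∀ p → p ℕ.≤ m → T p ≡ 0
    all-0 p p≤m = ℕP.n≤0⇒n≡0 (subst (T p ℕ.≤_) Tq≡0 (greatest p p≤m))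
    last-zero : residue (+ n - + 0) ≡ + 0
    last-zero = trans (cong residue (ℤP.+-identityʳ (+ n))) residue-n
    measure-zero : μ↓ T ≡ 0
    measure-zero = trans (sumBelow-cong (suc m) (λ p p<1+m → all-0 p (ℕP.≤-pred p<1+m)))
                         (trans (sumBelow-const (suc m) 0) (ℕP.*-zeroʳ (suc m)))
  ...   | no Tq≢0 =
    inj₂ (T' , i , mv , (adm' , target-∣ {R} {i} {vertexOf n m T} {vertexOf n m T'} mv) , measure-step)
    where
    T' : ℕ → ℕ
    T' = T [ q ]≔ ℕ.pred (T q)
    i : Fin (suc m)
    i = proj₁ (index q q≤m)
    adm' : Admissible n m T'
    adm' = lower-admissible adm q≤m greatest
    back-up : T q ≡ suc (T' q)
    back-up = trans (sym (ℕP.suc-pred (T q) {{ℕ.≢-nonZero Tq≢0}})) (cong suc (sym (update-at T q (ℕ.pred (T q)))))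
    raised : RaisedAt n m T' (toℕ i) T
    raised = subst (λ a → RaisedAt n m T' a T) (sym (proj₂ (index q q≤m)))
                   (back-up , λ p p≢q → sym (update-other T q (ℕ.pred (T q)) p p≢q))
    mv : Move n m R i (vertexOf n m T) (vertexOf n m T')
    mv = flip-move n m {i} {vertexOf n m T'} {vertexOf n m T} (raise-move n m i adm' adm raised (inj₂ n∣T))
    measure-step : μ↓ T ≡ suc (μ↓ T')
    measure-step = sumBelow-step (suc m) q (s≤s q≤m) back-up
      (λ p _ p≢q → sym (update-other T q (ℕ.pred (T q)) p p≢q))


module PivotFree (n m : ℕ) .{{_ : ℕ.NonZero n}} (v : V m) (vertex : IsVertex n m v)
                 (pivot-free : ∀ p → p ℕ.≤ m → ¬ (+ n ∣ prefix v p)) where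
  open Residue n

  inner-bounds : ∀ p → p ℕ.< m → -1ℤ ≤ at v (suc p) × at v (suc p) ≤ + 1
  inner-bounds p p<m = subst (λ x → -1ℤ ≤ x × x ≤ + 1) (sym at≡lookup) (proj₁ (proj₂ (proj₂ vertex)) j)
    where
    j : Fin m
    j = fromℕ< p<m
    at≡lookup : at v (suc p) ≡ lookup v (fs (inject₁ j))
    at≡lookup = trans (cong (λ k → at v (suc k)) (sym (trans (FinP.toℕ-inject₁ j) (FinP.toℕ-fromℕ< p<m))))
                      (at-lookup v (fs (inject₁ j)))

  natural-below : ∀ {x} → + 0 ≤ x → x < + n → Σ ℕ λ a → x ≡ + a × a ℕ.< n
  natural-below (+≤+ {n = a} _) x<n = a , refl , ℤP.drop‿+<+ x<n

  first-entry : Σ ℕ λ a → lookup v fz ≡ + a × a ℕ.< n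
  first-entry = natural-below (proj₁ (proj₁ vertex)) (proj₂ (proj₁ vertex))

  last-entry : Σ ℕ λ a → at v (suc m) ≡ + a × a ℕ.< n
  last-entry with natural-below (proj₁ (proj₁ (proj₂ vertex))) (proj₂ (proj₁ (proj₂ vertex)))
  ... | a , last≡a , a<n = a , trans at≡last last≡a , a<n
    where at≡last : at v (suc m) ≡ lookup v (lastIx n m)
          at≡last = trans (cong (at v) (sym (FinP.toℕ-fromℕ (suc m)))) (at-lookup v (lastIx n m))

  -- The prefix sums up to m all lie in [1, n-1]: they move by at most one per step and avoid 0 and n.
  prefix-range : ∀ p → p ℕ.≤ m → Σ ℕ λ t → prefix v p ≡ + t × 1 ℕ.≤ t × t ℕ.< n
  prefix-range zero _ with first-entry
  ... | zero  , v₀≡0 , _   = ⊥-elim (pivot-free 0 z≤n (subst (+ n ∣_) (sym (trans (prefix-zero v) v₀≡0)) (∣-0 {+ n})))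
  ... | suc a , v₀≡a , a<n = suc a , trans (prefix-zero v) v₀≡a , s≤s z≤n , a<n
  prefix-range (suc p) p<m with prefix-range p (ℕP.<⇒≤ p<m)
  ... | t , P≡t , 1≤t , t<n with add-increment t (at v (suc p)) 1≤t (proj₁ (inner-bounds p p<m)) (proj₂ (inner-bounds p p<m))
  ...   | t′ , t+x≡t′ , (_ , t′≤1+t) = t′ , P′≡t′ , positive , below-n
    where
    P′≡t′ : prefix v (suc p) ≡ + t′
    P′≡t′ = trans (prefix-suc v p) (trans (cong (_+ at v (suc p)) P≡t) t+x≡t′)
    not-pivot : ∀ {x} → + t′ ≡ x → ¬ (+ n ∣ x)
    not-pivot t′≡x n∣x = pivot-free (suc p) p<m (subst (+ n ∣_) (sym (trans P′≡t′ t′≡x)) n∣x)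
    positive : 1 ℕ.≤ t′
    positive = ℕP.n≢0⇒n>0 (λ t′≡0 → not-pivot (cong +_ t′≡0) (∣-0 {+ n}))
    below-n : t′ ℕ.< n
    below-n = ℕP.≤∧≢⇒< (ℕP.≤-trans t′≤1+t t<n) (λ t′≡n → not-pivot (cong +_ t′≡n) ℕDiv.∣-refl)

  T : ℕ → ℕ
  T p = ∣ prefix v p ∣

  T-prefix : ∀ p → p ℕ.≤ m → + T p ≡ prefix v p
  T-prefix p p≤m with prefix-range p p≤m
  ... | t , P≡t , _ = trans (cong (+_ ∘ ∣_∣) P≡t) (sym P≡t)

  T-admissible : Admissible n m T
  T-admissible = record { bounded = bounded ; lipschitz = lipschitz }
    where
    bounded : ∀ p → p ℕ.≤ m → T p ℕ.≤ n
    bounded p p≤m with prefix-range p p≤m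
    ... | t , P≡t , _ , t<n = subst (ℕ._≤ n) (sym (cong ∣_∣ P≡t)) (ℕP.<⇒≤ t<n)
    lipschitz : ∀ p → p ℕ.< m → T p ≈₁ T (suc p)
    lipschitz p p<m with prefix-range p (ℕP.<⇒≤ p<m)
    ... | t , P≡t , 1≤t , _ with add-increment t (at v (suc p)) 1≤t (proj₁ (inner-bounds p p<m)) (proj₂ (inner-bounds p p<m))
    ...   | t′ , t+x≡t′ , t≈t′ = subst₂ _≈₁_ (sym (cong ∣_∣ P≡t)) (sym T′≡t′) t≈t′
      where
      T′≡t′ : T (suc p) ≡ t′
      T′≡t′ = cong ∣_∣ (trans (prefix-suc v p) (trans (cong (_+ at v (suc p)) P≡t) t+x≡t′))

  -- The entries add up to exactly n: their sum lies in [1, 2n-1] and is a multiple of n.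
  sum-is-n : zsum v ≡ + n
  sum-is-n with prefix-range m ℕP.≤-refl | last-entry
  ... | t , P≡t , 1≤t , t<n | a , last≡a , a<n = trans sum≡ (cong +_ (multiple-between n (t ℕ.+ a)
          (ℕP.≤-trans 1≤t (ℕP.m≤m+n t a)) (ℕP.+-mono-< t<n a<n) (subst (+ n ∣_) sum≡ (proj₂ (proj₂ (proj₂ vertex))))))
    where
    sum≡ : zsum v ≡ + (t ℕ.+ a)
    sum≡ = trans (zsum-prefix v) (trans (cong₂ _+_ P≡t last≡a) (sym (ℤP.pos-+ t a)))

  T-encodes : vertexOf n m T ≡ v
  T-encodes = vertexOf-≡ n m T v (λ j → trans (entry≡ (toℕ j) (FinP.toℕ≤pred[n] j)) (at-lookup v j))
    where
    entry≡ : ∀ k → k ℕ.≤ suc m → entry n m T k ≡ at v k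
    entry≡ zero _ with first-entry
    ... | a , v₀≡a , a<n = begin
      residue (+ T 0)      ≡⟨ cong residue (trans (T-prefix 0 z≤n) (trans (prefix-zero v) v₀≡a)) ⟩
      residue (+ a)        ≡⟨ residue-small a a<n ⟩
      + a                  ≡⟨ v₀≡a ⟨
      lookup v fz          ≡⟨ at-lookup v fz ⟨
      at v 0               ∎
      where open ≡-Reasoning
    entry≡ (suc k) k<1+m with ℕP.m≤n⇒m<n∨m≡n (ℕP.≤-pred k<1+m)
    ... | inj₁ k<m = begin
      entry n m T (suc k)               ≡⟨ entry-inner n m T k k<m ⟩
      + T (suc k) - + T k               ≡⟨ cong₂ _-_ (T-prefix (suc k) k<m) (T-prefix k (ℕP.<⇒≤ k<m)) ⟩
      prefix v (suc k) - prefix v k     ≡⟨ cong (_- prefix v k) (prefix-suc v k) ⟩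
      prefix v k + at v (suc k) - prefix v k ≡⟨ cancel (prefix v k) (at v (suc k)) ⟩
      at v (suc k)                      ∎
      where
      open ≡-Reasoning
      cancel : ∀ (P x : ℤ) → P + x - P ≡ x
      cancel = solve-∀
    ... | inj₂ refl with last-entry
    ...   | a , last≡a , a<n = begin
      entry n m T (suc m)               ≡⟨ entry-last n m T ⟩
      residue (+ n - + T m)             ≡⟨ cong (λ x → residue (x - + T m)) (sym sum-is-n) ⟩
      residue (zsum v - + T m)          ≡⟨ cong (λ x → residue (zsum v - x)) (T-prefix m ℕP.≤-refl) ⟩
      residue (zsum v - prefix v m)     ≡⟨ cong (λ x → residue (x - prefix v m)) (zsum-prefix v) ⟩
      residue (prefix v m + at v (suc m) - prefix v m) ≡⟨ cong residue (cancel (prefix v m) (at v (suc m))) ⟩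
      residue (at v (suc m))            ≡⟨ cong residue last≡a ⟩
      residue (+ a)                     ≡⟨ residue-small a a<n ⟩
      + a                               ≡⟨ last≡a ⟨
      at v (suc m)                      ∎
      where
      open ≡-Reasoning
      cancel : ∀ (P x : ℤ) → P + x - P ≡ x
      cancel = solve-∀


module Bounds (n m : ℕ) .{{_ : ℕ.NonZero n}} (v : V m) (vertex : IsVertex n m v)
            (pivot-free : ∀ p → p ℕ.≤ m → ¬ (+ n ∣ prefix v p)) where
  open PivotFree n m v vertex pivot-free public

  good : Good n m T
  good = T-admissible , subst (λ u → + n ∣ zsum u) (sym T-encodes) (proj₂ (proj₂ (proj₂ vertex)))

  up : Descent n m L (μ↑ n m) T
  up = descend n m L (μ↑ n m) (raise-step n m) T good

  down : Descent n m R (μ↓ n m) T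
  down = descend n m R (μ↓ n m) (lower-step n m) T good

  up-path : Path n m v (zeroV n m) (proj₁ up)
  up-path = subst (λ u → Path n m u (zeroV n m) (proj₁ up)) T-encodes (proj₁ (proj₂ up))

  down-path : Path n m v (zeroV n m) (proj₁ down)
  down-path = subst (λ u → Path n m u (zeroV n m) (proj₁ down)) T-encodes (proj₁ (proj₂ down))

  up-no-R : ∀ i → ¬ ((R , i) ∈ proj₁ up)
  up-no-R i R∈ with All.lookup (proj₂ (proj₂ (proj₂ up))) R∈
  ... | ()

  down-no-L : ∀ i → ¬ ((L , i) ∈ proj₁ down)
  down-no-L i L∈ with All.lookup (proj₂ (proj₂ (proj₂ down))) L∈
  ... | ()

  -- The two measures add up to (m+1)·n, and so do the two potentials of v (its entries sum to n).
  measures-sum : μ↑ n m T ℕ.+ μ↓ n m T ≡ suc m ℕ.* n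
  measures-sum = trans (sumBelow-+ (suc m) (λ p → n ℕ.∸ T p) T)
                       (trans (sumBelow-cong (suc m) (λ p p<1+m → ℕP.m∸n+n≡m (below-n p (ℕP.≤-pred p<1+m))))
                              (sumBelow-const (suc m) n))
    where below-n : ∀ p → p ℕ.≤ m → T p ℕ.≤ n
          below-n = Admissible.bounded T-admissible

  potentials-sum : Φ n m v + Ψ n m v ≡ + (suc m ℕ.* n)
  potentials-sum = trans (weightedSum-complement (λ i → + i) (λ i → + (suc m ℕ.∸ i)) (+ suc m) v complementary)
                         (trans (cong (+ suc m *_) sum-is-n) (sym (ℤP.pos-* (suc m) n)))
    where
    complementary : ∀ i → i ℕ.< suc (suc m) → + i + + (suc m ℕ.∸ i) ≡ + suc m
    complementary i i<2+m = trans (sym (ℤP.pos-+ i (suc m ℕ.∸ i))) (cong +_ (ℕP.m+[n∸m]≡n (ℕP.≤-pred i<2+m)))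

  Φ≤μ↑ : Φ n m v ≤ + μ↑ n m T
  Φ≤μ↑ = subst (λ k → Φ n m v ≤ + k) (proj₁ (proj₂ (proj₂ up))) (Φ-lowerBound n m up-path (up-no-R (fromℕ m)))

  Ψ≤μ↓ : Ψ n m v ≤ + μ↓ n m T
  Ψ≤μ↓ = subst (λ k → Ψ n m v ≤ + k) (proj₁ (proj₂ (proj₂ down))) (Ψ-lowerBound n m down-path (down-no-L fz))

  bounds-sum : + μ↑ n m T + + μ↓ n m T ≡ Φ n m v + Ψ n m v
  bounds-sum = trans (sym (ℤP.pos-+ (μ↑ n m T) (μ↓ n m T))) (trans (cong +_ measures-sum) (sym potentials-sum))

  Φ≡μ↑ : Φ n m v ≡ + μ↑ n m T
  Φ≡μ↑ = squeeze Φ≤μ↑ Ψ≤μ↓ bounds-sum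

  Ψ≡μ↓ : Ψ n m v ≡ + μ↓ n m T
  Ψ≡μ↓ = squeeze Ψ≤μ↓ Φ≤μ↑
    (trans (ℤP.+-comm (+ μ↓ n m T) (+ μ↑ n m T)) (trans bounds-sum (ℤP.+-comm (Φ n m v) (Ψ n m v))))

  ps-last : PsIs n m (+ suc m) v (μ↑ n m T)
  ps-last = (proj₁ up , up-path , wall , proj₁ (proj₂ (proj₂ up))) , minimal
    where
    wall : Wall n m (+ suc m) (proj₁ up)
    wall = (λ ()) , (λ _ → up-no-R (fromℕ m)) ,
           (λ i 1+m≡i → ⊥-elim (ℕP.<⇒≢ (s≤s (FinP.toℕ≤pred[n] i)) (ℤP.+-injective (sym 1+m≡i))))
    minimal : ∀ ws → Path n m v (zeroV n m) ws → Wall n m (+ suc m) ws → μ↑ n m T ℕ.≤ length ws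
    minimal ws path (_ , no-R , _) = ℤP.drop‿+≤+ (subst (_≤ + length ws) Φ≡μ↑ (Φ-lowerBound n m path (no-R refl)))

  ps-first : PsIs n m -1ℤ v (μ↓ n m T)
  ps-first = (proj₁ down , down-path , wall , proj₁ (proj₂ (proj₂ down))) , minimal
    where
    wall : Wall n m -1ℤ (proj₁ down)
    wall = (λ _ → down-no-L fz) , (λ ()) , (λ i ())
    minimal : ∀ ws → Path n m v (zeroV n m) ws → Wall n m -1ℤ ws → μ↓ n m T ℕ.≤ length ws
    minimal ws path (no-L , _ , _) = ℤP.drop‿+≤+ (subst (_≤ + length ws) Ψ≡μ↓ (Ψ-lowerBound n m path (no-L refl)))

  short-enough : ∀ {ℓ μ} → ℓ ≡ μ → μ ℕ.≤ (μ↑ n m T ℕ.+ μ↓ n m T) ℕ./ 2 → ℓ ℕ.≤ (n ℕ.* suc m) ℕ./ 2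
  short-enough {ℓ} refl short = subst (λ N → ℓ ℕ.≤ N ℕ./ 2) (trans measures-sum (ℕP.*-comm (suc m) n)) short

  short-path : Σ (List (Label n m)) λ ws → Path n m v (zeroV n m) ws × length ws ℕ.≤ (n ℕ.* suc m) ℕ./ 2
  short-path with half-of-sum (μ↑ n m T) (μ↓ n m T)
  ... | inj₁ short = proj₁ up , up-path , short-enough (proj₁ (proj₂ (proj₂ up))) short
  ... | inj₂ short = proj₁ down , down-path , short-enough (proj₁ (proj₂ (proj₂ down))) short

no-inner-pivot : ∀ n m (v : V m) → (∀ (p : ℤ) → IsPivot n m v p ⇔ (p ≡ -1ℤ ⊎ p ≡ + suc m)) →
                 ∀ p → p ℕ.≤ m → ¬ (+ n ∣ prefix v p)
no-inner-pivot n m v pivots p p≤m n∣prefix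
  with Equivalence.to (pivots (+ p)) (-≤+ , +≤+ (ℕP.m≤n⇒m≤1+n p≤m) ,
                                      subst (λ k → + n ∣ zsumL (take k (toList v))) (ℕP.+-comm 1 p) n∣prefix)
... | inj₂ p≡1+m = ℕP.<⇒≢ (s≤s p≤m) (ℤP.+-injective p≡1+m)

lemma5p15 : (n m : ℕ) → 2 ℕ.≤ n → 1 ℕ.≤ m → (v : V m) → IsVertex n m v →
    (∀ (p : ℤ) → IsPivot n m v p ⇔ (p ≡ -1ℤ ⊎ p ≡ + suc m)) →
    (Σ ℕ λ k → PsIs n m (+ suc m) v k × + k ≡ weightedSum (λ i → + i) v) ×
    (Σ ℕ λ k → PsIs n m -1ℤ v k × + k ≡ weightedSum (λ i → + (suc m ℕ.∸ i)) v) ×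
    (Σ (List (Label n m)) λ ws → Path n m v (zeroV n m) ws × length ws ℕ.≤ (n ℕ.* suc m) ℕ./ 2)
lemma5p15 n m 2≤n _ v vertex pivots =
  (μ↑ n m T , ps-last , sym Φ≡μ↑) , (μ↓ n m T , ps-first , sym Ψ≡μ↓) , short-path
  where
  instance
    n≢0 : ℕ.NonZero n
    n≢0 = ℕ.>-nonZero (ℕP.<-trans (s≤s z≤n) 2≤n)
  open Bounds n m v vertex (no-inner-pivot n m v pivots)
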